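{- Let $D(n)$ be the central Delannoy numbers, satisfying $D(0)=1$, $D(1)=3$ and $nD(n)=3(2n-1)D(n-1)-(n-1)D(n-2)$ for $n\ge2$. Then $\{D(n)\}_{n\ge0}$ is log-convex.
   Context: Combinatorially, $D(n)$ is the number of lattice paths from $(0,0)$ to $(n,n)$ with steps $(1,0),(0,1),(1,1)$. A sequence of positive numbers $\{z_n\}$ is log-convex if $z_{k-1}z_{k+1}\ge z_k^2$ for all $k\ge1$. -}

module Defs where

open import Data.Nat using (ℕ; zero; suc; _+_; _*_; _≤_)
open import Relation.Binary.PropositionalEquality using (_≡_)

-- The central Delannoy recurrence, for n = k + 2 ≥ 2:
--   n D(n) = 3(2n-1) D(n-1) - (n-1) D(n-2)
-- rewritten without subtraction (all terms are natural numbers):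
--   (k+2) D(k+2) + (k+1) D(k) = 3 (2k+3) D(k+1)
IsCentralDelannoy : (ℕ → ℕ) → Set
IsCentralDelannoy D =
  (D 0 ≡ 1) × (D 1 ≡ 3) ×
  (∀ k → suc (suc k) * D (suc (suc k)) + suc k * D k ≡ 3 * (2 * k + 3) * D (suc k))
  where open import Data.Product using (_×_)

LogConvex : (ℕ → ℕ) → Set
LogConvex z = ∀ k → z (suc k) * z (suc k) ≤ z k * z (suc (suc k))

-- Writing x, y, z, w for D k, D (k + 1), D (k + 2), D (k + 3), eliminating w with the
-- recurrence at k + 1 and then z with the recurrence at k gives
--   (k+2)²(k+3) (y w − z²) = (k+1)(k+2)(k+3) (x z − y²) + y ((17k+25) y − 3(k+1) x).
-- If x ≤ y and x z ≥ y², the right side is nonnegative, so y w ≥ z²; and y² ≤ x z ≤ y z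
-- gives y ≤ z. Positivity, monotonicity and log-convexity thus propagate together by
-- induction from D = 1, 3, 13.
module Submission where

open import Defs
open import Data.Nat using (ℕ; zero; suc; _+_; _*_; _≤_; >-nonZero)
open import Data.Nat.Properties
open import Data.Nat.Tactic.RingSolver using (solve-∀)
open import Data.Product using (_,_)
open import Relation.Binary.PropositionalEquality

DelannoyStep : ℕ → ℕ → ℕ → ℕ → Set
DelannoyStep k x y z = suc (suc k) * z + suc k * x ≡ 3 * (2 * k + 3) * y

-- The identity with each recurrence, times its multiplier, added to both sides in
-- opposite orientations, so that it holds as a polynomial identity over ℕ.
private
  delannoy-identity-padded : ∀ k x y z w →
    (suc (suc k) * suc (suc k) * suc (suc (suc k))) * (y * w)
      + (suc k * suc (suc k) * suc (suc (suc k)) * (y * y) + 3 * suc k * (x * y))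
      + (suc (suc k) * suc (suc k) * y * (3 * (2 * suc k + 3) * z)
         + 3 * y * (3 * (2 * k + 3) * y)
         + suc (suc k) * suc (suc (suc k)) * z * (suc (suc k) * z + suc k * x))
    ≡ (suc (suc k) * suc (suc k) * suc (suc (suc k))) * (z * z)
      + (suc k * suc (suc k) * suc (suc (suc k)) * (x * z) + (17 * k + 25) * (y * y))
      + (suc (suc k) * suc (suc k) * y * (suc (suc (suc k)) * w + suc (suc k) * y)
         + 3 * y * (suc (suc k) * z + suc k * x)
         + suc (suc k) * suc (suc (suc k)) * z * (3 * (2 * k + 3) * y))
  delannoy-identity-padded = solve-∀

delannoy-identity : ∀ k x y z w → DelannoyStep k x y z → DelannoyStep (suc k) y z w →
  (suc (suc k) * suc (suc k) * suc (suc (suc k))) * (y * w)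
    + (suc k * suc (suc k) * suc (suc (suc k)) * (y * y) + 3 * suc k * (x * y))
  ≡ (suc (suc k) * suc (suc k) * suc (suc (suc k))) * (z * z)
    + (suc k * suc (suc k) * suc (suc (suc k)) * (x * z) + (17 * k + 25) * (y * y))
delannoy-identity k x y z w e₁ e₂ =
  +-cancelʳ-≡ _ _ _ (trans (delannoy-identity-padded k x y z w)
    (cong (lhs +_) (cong₂ _+_ (cong₂ _+_ (cong (k₂ * k₂ * y *_) e₂) (cong (3 * y *_) e₁))
                              (cong (k₂ * suc k₂ * z *_) (sym e₁)))))
  where
  k₂ = suc (suc k)
  lhs = k₂ * k₂ * suc k₂ * (z * z) + (suc k * k₂ * suc k₂ * (x * z) + (17 * k + 25) * (y * y))

≤-from-balance : ∀ {p q r s} → p + r ≡ q + s → r ≤ s → q ≤ p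
≤-from-balance {p} {q} {r} {s} p+r≡q+s r≤s = +-cancelʳ-≤ s q p (begin
  q + s ≡⟨ sym p+r≡q+s ⟩
  p + r ≤⟨ +-monoʳ-≤ p r≤s ⟩
  p + s ∎)
  where open ≤-Reasoning

log-convex⇒nondecreasing : ∀ {x y z} → 1 ≤ y → x ≤ y → y * y ≤ x * z → y ≤ z
log-convex⇒nondecreasing {y = y} {z} 1≤y x≤y yy≤xz =
  *-cancelˡ-≤ y {{>-nonZero 1≤y}} (≤-trans yy≤xz (*-monoˡ-≤ z x≤y))

delannoy-log-convex-step : ∀ k x y z w → DelannoyStep k x y z → DelannoyStep (suc k) y z w →
  x ≤ y → y * y ≤ x * z → z * z ≤ y * w
delannoy-log-convex-step k x y z w e₁ e₂ x≤y yy≤xz =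
  *-cancelˡ-≤ (k₂ * k₂ * suc k₂)
    (≤-from-balance (delannoy-identity k x y z w e₁ e₂)
      (+-mono-≤ (*-monoʳ-≤ (suc k * k₂ * suc k₂) yy≤xz) (*-mono-≤ 3[k+1]≤17k+25 (*-monoˡ-≤ y x≤y))))
  where
  k₂ = suc (suc k)
  3[k+1]≤17k+25 : 3 * suc k ≤ 17 * k + 25
  3[k+1]≤17k+25 = subst (3 * suc k ≤_) (split k) (m≤m+n (3 * suc k) (14 * k + 22))
    where
    split : ∀ k → 3 * suc k + (14 * k + 22) ≡ 17 * k + 25
    split = solve-∀

record MonotoneLogConvex (x y z : ℕ) : Set where
  field
    positive      : 1 ≤ x
    nondecreasing : x ≤ y
    logConvex     : y * y ≤ x * z

delannoy-propagate : ∀ k x y z w → DelannoyStep k x y z → DelannoyStep (suc k) y z w →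
  MonotoneLogConvex x y z → MonotoneLogConvex y z w
delannoy-propagate k x y z w e₁ e₂ xyz = record
  { positive      = 1≤y
  ; nondecreasing = log-convex⇒nondecreasing 1≤y nondecreasing logConvex
  ; logConvex     = delannoy-log-convex-step k x y z w e₁ e₂ nondecreasing logConvex
  }
  where
  open MonotoneLogConvex xyz
  1≤y = ≤-trans positive nondecreasing

delannoy-third-term : ∀ {z} → DelannoyStep 0 1 3 z → z ≡ 13
delannoy-third-term {z} e = *-cancelˡ-≡ z 13 2 (+-cancelʳ-≡ 1 (2 * z) (2 * 13) e)

delannoy-base : ∀ {x y z} → x ≡ 1 → y ≡ 3 → DelannoyStep 0 x y z → MonotoneLogConvex x y z
delannoy-base refl refl e = subst (MonotoneLogConvex 1 3) (sym (delannoy-third-term e))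
  record { positive = ≤-refl ; nondecreasing = m≤m+n 1 2 ; logConvex = m≤m+n 9 4 }

delannoy-monotone-log-convex : ∀ D → IsCentralDelannoy D →
  ∀ k → MonotoneLogConvex (D k) (D (suc k)) (D (suc (suc k)))
delannoy-monotone-log-convex D (D₀ , D₁ , rec) zero = delannoy-base D₀ D₁ (rec 0)
delannoy-monotone-log-convex D h@(_ , _ , rec) (suc k) =
  delannoy-propagate k _ _ _ _ (rec k) (rec (suc k)) (delannoy-monotone-log-convex D h k)

corollary3p12 : (D : ℕ → ℕ) → IsCentralDelannoy D → LogConvex D
corollary3p12 D h k = MonotoneLogConvex.logConvex (delannoy-monotone-log-convex D h k)
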